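{- For all integers $r,k\geq 1$, we have $s_r(K_{k+1}) \geq P_r(k)$.
   Context: All graphs are finite and simple; $K_k$ denotes the complete graph on $k$ vertices. A graph $G$ is $r$-Ramsey for a graph $H$ if every colouring of the edges of $G$ with $r$ colours contains a monochromatic copy of $H$. A graph $G$ is $r$-Ramsey-minimal for $H$ if it is $r$-Ramsey for $H$ but no proper subgraph is. Define $s_r(H)$ as the minimum of $\delta(G)$ (minimum degree) over all $r$-Ramsey-minimal graphs $G$ for $H$. A colour pattern on a vertex set $V$ is a sequence $G_1,\ldots,G_r$ of pairwise edge-disjoint graphs all with vertex set $V$; it is $H$-free if no $G_i$ contains $H$ as a subgraph. Given a colour pattern $G_1,\dots,G_r$ on $V$ and a colouring $c:V\to[r]$, a strongly monochromatic $K_k$ is a set of $k$ vertices all of the same colour $i$ under $c$ which forms a clique in $G_i$. $P_r(k)$ is the smallest integer $n$ such that there exists a $K_{k+1}$-free colour pattern $G_1,\ldots,G_r$ on an $n$-element vertex set $V$ such that every colouring $V\to[r]$ contains a strongly monochromatic $K_k$. -}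

module Defs where

open import Data.Nat using (ℕ; zero; suc; _+_; _⊔_; _⊓_; _≤_)
open import Data.Fin using (Fin; zero; suc; _≟_)
open import Data.Bool using (Bool; true; false; not; if_then_else_)
open import Data.Product using (Σ; ∃; _×_; _,_)
open import Data.Empty using (⊥)
open import Relation.Nullary using (¬_; yes; no; does)
open import Relation.Binary.PropositionalEquality using (_≡_; _≢_; refl; sym)
open import Function.Definitions using (Injective)

record Graph (n : ℕ) : Set where
  field
    adj   : Fin n → Fin n → Bool
    adj-sym   : ∀ u v → adj u v ≡ adj v u
    adj-irrefl : ∀ v → adj v v ≡ false

open Graph public

E : ∀ {n} → Graph n → Fin n → Fin n → Set
E G u v = adj G u v ≡ true

K-adj : ∀ {k} → Fin k → Fin k → Bool
K-adj a b = not (does (a ≟ b))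

K-sym : ∀ {k} (a b : Fin k) → K-adj a b ≡ K-adj b a
K-sym a b with a ≟ b | b ≟ a
... | yes _ | yes _ = refl
... | no _ | no _ = refl
... | yes p | no q with q (sym p)
... | ()
K-sym a b | no p | yes q with p (sym q)
... | ()

K-irrefl : ∀ {k} (a : Fin k) → K-adj a a ≡ false
K-irrefl a with a ≟ a
... | yes _ = refl
... | no p with p refl
... | ()

K : (k : ℕ) → Graph k
K k = record { adj = K-adj ; adj-sym = K-sym ; adj-irrefl = K-irrefl }

SubgraphEmb : ∀ {m n} → Graph m → Graph n → (Fin m → Fin n) → Set
SubgraphEmb H G f = Injective _≡_ _≡_ f × (∀ a b → E H a b → E G (f a) (f b))

Surj : ∀ {m n} → (Fin m → Fin n) → Set
Surj f = ∀ y → ∃ λ x → f x ≡ y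

ProperSubgraph : ∀ {m n} → Graph m → Graph n → Set
ProperSubgraph H G =
  Σ _ λ f → SubgraphEmb H G f ×
    ¬ (Surj f × (∀ a b → E G (f a) (f b) → E H a b))

ContainsCopy : ∀ {m n} → Graph n → Graph m → Set
ContainsCopy G H = Σ _ λ f → SubgraphEmb H G f

-- Edge colourings of G with r colours: symmetric function on pairs
-- (only values on edges of G matter).
EdgeColouring : ℕ → ℕ → Set
EdgeColouring r n = Σ (Fin n → Fin n → Fin r) λ c → ∀ u v → c u v ≡ c v u

MonoCopy : ∀ {r m n} → Graph m → Graph n → (Fin n → Fin n → Fin r) → Set
MonoCopy {r} H G c =
  Σ (Fin r) λ i → Σ _ λ f → Injective _≡_ _≡_ f ×
    (∀ a b → E H a b → E G (f a) (f b) × c (f a) (f b) ≡ i)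

Ramsey : ∀ {m n} → ℕ → Graph m → Graph n → Set
Ramsey r H G = (c : EdgeColouring r _) → MonoCopy H G (Data.Product.proj₁ c)

RamseyMinimal : ∀ {m n} → ℕ → Graph m → Graph n → Set
RamseyMinimal r H G =
  Ramsey r H G × (∀ {m'} (G' : Graph m') → ProperSubgraph G' G → ¬ Ramsey r H G')

countTrue : ∀ {n} → (Fin n → Bool) → ℕ
countTrue {zero} p = 0
countTrue {suc n} p = (if p zero then 1 else 0) + countTrue (λ i → p (suc i))

degree : ∀ {n} → Graph n → Fin n → ℕ
degree G v = countTrue (adj G v)

minOver : ∀ {n} → (Fin (suc n) → ℕ) → ℕ
minOver {zero} f = f zero
minOver {suc n} f = f zero ⊓ minOver (λ i → f (suc i))

-- minimum degree δ(G) (convention: 0 for the empty graph)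
minDegree : ∀ {n} → Graph n → ℕ
minDegree {zero} G = 0
minDegree {suc n} G = minOver (degree G)

PairwiseEdgeDisjoint : ∀ {r n} → (Fin r → Graph n) → Set
PairwiseEdgeDisjoint {r} {n} Gs =
  ∀ (i j : Fin r) (u v : Fin n) → i ≢ j → E (Gs i) u v → E (Gs j) u v → ⊥

HFreePattern : ∀ {r m n} → Graph m → (Fin r → Graph n) → Set
HFreePattern H Gs = ∀ i → ¬ ContainsCopy (Gs i) H

StronglyMonoK : ∀ {r n} → ℕ → (Fin r → Graph n) → (Fin n → Fin r) → Set
StronglyMonoK {r} {n} k Gs c =
  Σ (Fin r) λ i → Σ (Fin k → Fin n) λ f → Injective _≡_ _≡_ f ×
    (∀ a → c (f a) ≡ i) × (∀ a b → a ≢ b → E (Gs i) (f a) (f b))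

-- n-vertex witness for P_r(k): a K_{k+1}-free colour pattern on n vertices
-- such that every vertex colouring has a strongly monochromatic K_k.
-- P_r(k) is the least n with PrWitness r k n.
PrWitness : ℕ → ℕ → ℕ → Set
PrWitness r k n =
  Σ (Fin r → Graph n) λ Gs → PairwiseEdgeDisjoint Gs × HFreePattern (K (suc k)) Gs ×
    ((c : Fin n → Fin r) → StronglyMonoK k Gs c)

-- Let v be a vertex of minimum degree in an r-Ramsey-minimal graph G for K_{k+1}.
-- Since G - v is a proper subgraph, it has a colouring c without monochromatic
-- K_{k+1}; splitting the edges inside the neighbourhood N(v) by their c-colour
-- gives a K_{k+1}-free colour pattern on deg v vertices. A vertex colouring χ of
-- N(v) extends c to a colouring of G by giving each edge vu the colour χ(u).
-- This colouring has a monochromatic K_{k+1}, which must pass through v, and its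
-- other k vertices form a strongly monochromatic K_k for χ.
-- Constructively, the colouring c is found by exhaustive search over all
-- colourings of G - v.
module Submission where

open import Defs
open import Level using (0ℓ)
open import Data.Nat using (ℕ; zero; suc; _≤_)
open import Data.Nat.Properties using (⊓-sel; ≤-reflexive)
open import Data.Fin using (Fin; zero; suc; _≟_; punchIn; punchOut)
open import Data.Fin.Properties
  using (any?; all?; suc-injective; punchIn-injective; punchInᵢ≢i;
         punchOut-cong; punchOut-injective; punchIn-punchOut)
open import Data.Bool using (Bool; true; false; _∧_)
open import Data.Bool.Properties using (∧-conicalˡ; ∧-conicalʳ)
import Data.Bool as Bool
open import Data.Product using (Σ; ∃; _×_; _,_; proj₁; proj₂)
open import Data.Sum using (inj₁; inj₂)
open import Data.Empty using (⊥-elim)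
open import Data.Vec.Functional using (Vector; _∷_; head; tail)
open import Data.Vec.Functional.Relation.Binary.Pointwise using (Pointwise)
open import Function using (_∘_)
open import Function.Definitions using (Injective)
open import Relation.Nullary using (¬_; Dec; yes; no; does; contradiction)
open import Relation.Nullary.Decidable
  using (map′; _×-dec_; _→-dec_; ¬?; decidable-stable; dec-true; dec-false)
open import Relation.Unary using (Pred; Decidable)
open import Relation.Binary using (Rel; Reflexive; _Respects_)
open import Relation.Binary.PropositionalEquality

Exhaustible : (A : Set) → Rel A 0ℓ → Set₁
Exhaustible A _~_ = (P : Pred A 0ℓ) → P Respects _~_ → Decidable P → Dec (∃ P)

Fin-exhaustible : ∀ {n} → Exhaustible (Fin n) _≡_
Fin-exhaustible P _ P? = any? P?

Vector-exhaustible : ∀ {A _~_} → Reflexive _~_ → Exhaustible A _~_ →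
                     ∀ m → Exhaustible (Vector A m) (Pointwise _~_)
Vector-exhaustible ~-refl search zero P resp P? with P? (λ ())
... | yes p = yes (_ , p)
... | no ¬p = no λ (_ , p) → ¬p (resp (λ ()) p)
Vector-exhaustible {A} {_~_} ~-refl search (suc m) P resp P? =
  map′ (λ (x , xs , p) → x ∷ xs , p) (λ (f , p) → head f , tail f , resp (head-tail f) p)
       (search Q Q-resp Q?)
  where
  Q : Pred A 0ℓ
  Q x = ∃ λ xs → P (x ∷ xs)
  Q-resp : Q Respects _~_
  Q-resp x~y (xs , p) = xs , resp (λ { zero → x~y ; (suc i) → ~-refl }) p
  Q? : Decidable Q
  Q? x = Vector-exhaustible ~-refl search m (λ xs → P (x ∷ xs))
           (λ xs~ys → resp (λ { zero → ~-refl ; (suc i) → xs~ys i })) (λ xs → P? (x ∷ xs))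
  head-tail : ∀ f → Pointwise _~_ f (head f ∷ tail f)
  head-tail f zero = ~-refl
  head-tail f (suc i) = ~-refl

injective? : ∀ {m n} (f : Fin m → Fin n) → Dec (Injective _≡_ _≡_ f)
injective? f = map′ (λ inj → inj _ _) (λ inj _ _ → inj)
  (all? λ a → all? λ b → (f a ≟ f b) →-dec (a ≟ b))

E? : ∀ {n} (G : Graph n) u v → Dec (E G u v)
E? G u v = adj G u v Bool.≟ true

MonoAt : ∀ {r m n} → Graph m → Graph n → (Fin n → Fin n → Fin r) → Fin r → (Fin m → Fin n) → Set
MonoAt H G c i f = Injective _≡_ _≡_ f × (∀ a b → E H a b → E G (f a) (f b) × c (f a) (f b) ≡ i)

MonoAt-transport : ∀ {r m n} (H : Graph m) (G : Graph n) {c c' : Fin n → Fin n → Fin r} →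
  (∀ x y → c x y ≡ c' x y) → ∀ {i f g} → Pointwise _≡_ f g → MonoAt H G c i f → MonoAt H G c' i g
MonoAt-transport H G {c} c≐c' {f = f} {g} f≗g (f-inj , f-mono) =
  (λ {a} {b} ga≡gb → f-inj (trans (f≗g a) (trans ga≡gb (sym (f≗g b))))) ,
  λ a b ab → let (e , col) = f-mono a b ab in
    subst₂ (E G) (f≗g a) (f≗g b) e ,
    trans (sym (c≐c' (g a) (g b))) (trans (cong₂ c (sym (f≗g a)) (sym (f≗g b))) col)

MonoCopy-transport : ∀ {r m n} (H : Graph m) (G : Graph n) {c c' : Fin n → Fin n → Fin r} →
  (∀ x y → c x y ≡ c' x y) → MonoCopy H G c → MonoCopy H G c'
MonoCopy-transport H G c≐c' (i , f , mono) = i , f , MonoAt-transport H G c≐c' (λ _ → refl) mono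

MonoCopy? : ∀ {r m n} (H : Graph m) (G : Graph n) c → Dec (MonoCopy {r} H G c)
MonoCopy? {m = m} H G c = any? λ i →
  Vector-exhaustible refl Fin-exhaustible m (MonoAt H G c i)
    (MonoAt-transport H G {c} (λ _ _ → refl))
    (λ f → injective? f ×-dec all? λ a → all? λ b →
             E? H a b →-dec (E? G (f a) (f b) ×-dec (c (f a) (f b) ≟ i)))

¬Ramsey⇒badColouring : ∀ {r m n} (H : Graph m) (G : Graph n) → ¬ Ramsey r H G →
  Σ (EdgeColouring r n) λ c → ¬ MonoCopy H G (proj₁ c)
¬Ramsey⇒badColouring {n = n} H G ¬R with
  Vector-exhaustible (λ _ → refl) (Vector-exhaustible refl Fin-exhaustible n) n
    (λ c → (∀ x y → c x y ≡ c y x) × ¬ MonoCopy H G c)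
    (λ c≐c' (c-sym , ¬mono) →
       (λ x y → trans (sym (c≐c' x y)) (trans (c-sym x y) (c≐c' y x))) ,
       ¬mono ∘ MonoCopy-transport H G (λ x y → sym (c≐c' x y)))
    (λ c → (all? λ x → all? λ y → c x y ≟ c y x) ×-dec ¬? (MonoCopy? H G c))
... | yes (c , c-sym , ¬mono) = (c , c-sym) , ¬mono
... | no ∄ = ⊥-elim (¬R λ (c , c-sym) →
               decidable-stable (MonoCopy? H G c) λ ¬mono → ∄ (c , c-sym , ¬mono))

enumerate : ∀ {n} (p : Fin n → Bool) → Fin (countTrue p) → Fin n
enumerate {suc n} p with p zero
... | true  = λ { zero → zero ; (suc i) → suc (enumerate (p ∘ suc) i) }
... | false = suc ∘ enumerate (p ∘ suc)

enumerate-true : ∀ {n} (p : Fin n → Bool) i → p (enumerate p i) ≡ true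
enumerate-true {suc n} p i with p zero in eq
enumerate-true {suc n} p zero    | true  = eq
enumerate-true {suc n} p (suc i) | true  = enumerate-true (p ∘ suc) i
enumerate-true {suc n} p i       | false = enumerate-true (p ∘ suc) i

enumerate-injective : ∀ {n} (p : Fin n → Bool) → Injective _≡_ _≡_ (enumerate p)
enumerate-injective {suc n} p {i} {j} with p zero
enumerate-injective {suc n} p {zero}  {zero}  | true = λ _ → refl
enumerate-injective {suc n} p {zero}  {suc j} | true = λ ()
enumerate-injective {suc n} p {suc i} {zero}  | true = λ ()
enumerate-injective {suc n} p {suc i} {suc j} | true =
  cong suc ∘ enumerate-injective (p ∘ suc) ∘ suc-injective
enumerate-injective {suc n} p {i} {j} | false = enumerate-injective (p ∘ suc) ∘ suc-injective

enumerate-surjective : ∀ {n} (p : Fin n → Bool) {u} → p u ≡ true → ∃ λ i → enumerate p i ≡ u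
enumerate-surjective {suc n} p {u} pu with p zero in eq
enumerate-surjective {suc n} p {zero}  pu | true  = zero , refl
enumerate-surjective {suc n} p {suc u} pu | true  with enumerate-surjective (p ∘ suc) pu
... | i , e = suc i , cong suc e
enumerate-surjective {suc n} p {zero}  pu | false = contradiction (trans (sym eq) pu) λ ()
enumerate-surjective {suc n} p {suc u} pu | false with enumerate-surjective (p ∘ suc) pu
... | i , e = i , cong suc e

minOver-attained : ∀ {n} (f : Fin (suc n) → ℕ) → ∃ λ v → f v ≡ minOver f
minOver-attained {zero} f = zero , refl
minOver-attained {suc n} f with ⊓-sel (f zero) (minOver (f ∘ suc))
... | inj₁ e = zero , sym e
... | inj₂ e = let (v , e') = minOver-attained (f ∘ suc) in suc v , trans e' (sym e)

K-edge : ∀ {k} {a b : Fin k} → a ≢ b → E (K k) a b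
K-edge {a = a} {b} a≢b = cong Bool.not (dec-false (a ≟ b) a≢b)

deleteVertex : ∀ {n} → Graph (suc n) → Fin (suc n) → Graph n
deleteVertex G v = record
  { adj        = λ a b → adj G (punchIn v a) (punchIn v b)
  ; adj-sym    = λ a b → adj-sym G _ _
  ; adj-irrefl = λ a → adj-irrefl G _
  }

deleteVertex-proper : ∀ {n} (G : Graph (suc n)) v → ProperSubgraph (deleteVertex G v) G
deleteVertex-proper G v =
  punchIn v , ((λ {a} {b} → punchIn-injective v a b) , λ a b e → e) ,
  λ (surj , _) → let (a , e) = surj v in punchInᵢ≢i v a e

Ramsey-empty : ∀ {r k} (G : Graph 0) → ¬ Ramsey r (K (suc k)) G
Ramsey-empty G R with R ((λ ()) , λ ())
... | _ , f , _ with f zero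
... | ()

deleteVertex-edge : ∀ {n} (G : Graph (suc n)) {v x y} (v≢x : v ≢ x) (v≢y : v ≢ y) →
  E G x y → E (deleteVertex G v) (punchOut v≢x) (punchOut v≢y)
deleteVertex-edge G v≢x v≢y =
  subst₂ (E G) (sym (punchIn-punchOut v≢x)) (sym (punchIn-punchOut v≢y))

∧-true : ∀ {x y} → x ≡ true → y ≡ true → x ∧ y ≡ true
∧-true refl refl = refl

does-true : ∀ {A : Set} (a? : Dec A) → does a? ≡ true → A
does-true (yes a) _ = a

module NeighbourhoodPattern {r n} (G : Graph (suc n)) (v : Fin (suc n))
  (c : Fin n → Fin n → Fin (suc r)) (c-sym : ∀ x y → c x y ≡ c y x) where

  d : ℕ
  d = degree G v

  neighbour : Fin d → Fin (suc n)
  neighbour = enumerate (adj G v)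

  v≢neighbour : ∀ a → v ≢ neighbour a
  v≢neighbour a v≡ = contradiction
    (trans (sym (adj-irrefl G v)) (subst (E G v) (sym v≡) (enumerate-true (adj G v) a))) λ ()

  -- the position of a neighbour in G - v
  neighbour⁻ : Fin d → Fin n
  neighbour⁻ a = punchOut (v≢neighbour a)

  colourPattern : Fin (suc r) → Graph d
  colourPattern i = record
    { adj        = λ a b → adj G (neighbour a) (neighbour b)
                           ∧ does (c (neighbour⁻ a) (neighbour⁻ b) ≟ i)
    ; adj-sym    = λ a b → cong₂ _∧_ (adj-sym G _ _) (cong (λ x → does (x ≟ i)) (c-sym _ _))
    ; adj-irrefl = λ a → cong (_∧ does (c (neighbour⁻ a) (neighbour⁻ a) ≟ i)) (adj-irrefl G _)
    }

  colourPattern-edge : ∀ {i a b} → E (colourPattern i) a b →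
    E G (neighbour a) (neighbour b) × c (neighbour⁻ a) (neighbour⁻ b) ≡ i
  colourPattern-edge {i} {a} {b} e =
    ∧-conicalˡ _ _ e , does-true (c (neighbour⁻ a) (neighbour⁻ b) ≟ i) (∧-conicalʳ _ _ e)

  colourPattern-disjoint : PairwiseEdgeDisjoint colourPattern
  colourPattern-disjoint i j a b i≢j eᵢ eⱼ =
    i≢j (trans (sym (proj₂ (colourPattern-edge eᵢ))) (proj₂ (colourPattern-edge eⱼ)))

  colourPattern-K-free : ∀ {k} → ¬ MonoCopy (K (suc k)) (deleteVertex G v) c →
    HFreePattern (K (suc k)) colourPattern
  colourPattern-K-free ¬mono i (h , h-inj , h-edges) =
    ¬mono (i , neighbour⁻ ∘ h ,
           (λ {a} {b} → h-inj ∘ enumerate-injective (adj G v)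
                          ∘ punchOut-injective (v≢neighbour (h a)) (v≢neighbour (h b))) ,
           λ a b ab → let (e , col) = colourPattern-edge (h-edges a b ab) in
             deleteVertex-edge G (v≢neighbour (h a)) (v≢neighbour (h b)) e , col)

  extend : (Fin (suc n) → Fin (suc r)) → Fin (suc n) → Fin (suc n) → Fin (suc r)
  extend s x y with v ≟ x | v ≟ y
  ... | yes _   | _       = s y
  ... | no _    | yes _   = s x
  ... | no v≢x  | no v≢y  = c (punchOut v≢x) (punchOut v≢y)

  extend-sym : ∀ s x y → extend s x y ≡ extend s y x
  extend-sym s x y with v ≟ x | v ≟ y
  ... | yes v≡x | yes v≡y = cong s (trans (sym v≡y) v≡x)
  ... | yes _   | no _    = refl
  ... | no _    | yes _   = refl
  ... | no v≢x  | no v≢y  = c-sym (punchOut v≢x) (punchOut v≢y)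

  extend-at-v : ∀ s y → extend s v y ≡ s y
  extend-at-v s y with v ≟ v
  ... | yes _  = refl
  ... | no v≢v = contradiction refl v≢v

  extend-off-v : ∀ s {x y} (v≢x : v ≢ x) (v≢y : v ≢ y) →
    extend s x y ≡ c (punchOut v≢x) (punchOut v≢y)
  extend-off-v s {x} {y} v≢x v≢y with v ≟ x | v ≟ y
  ... | yes v≡x | _       = contradiction v≡x v≢x
  ... | no _    | yes v≡y = contradiction v≡y v≢y
  ... | no _    | no _    = cong₂ c (punchOut-cong v refl) (punchOut-cong v refl)

  mono-avoiding-v : ∀ {m} (H : Graph m) s {i f} → MonoAt H G (extend s) i f →
    (∀ a → v ≢ f a) → MonoCopy H (deleteVertex G v) c
  mono-avoiding-v H s {i} (f-inj , f-mono) v∉f =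
    i , (λ a → punchOut (v∉f a)) ,
    (λ {a} {b} → f-inj ∘ punchOut-injective (v∉f a) (v∉f b)) ,
    λ a b ab → let (e , col) = f-mono a b ab in
      deleteVertex-edge G (v∉f a) (v∉f b) e , trans (sym (extend-off-v s (v∉f a) (v∉f b))) col

  mono-through-v : ∀ {k} s χ → (∀ a → s (neighbour a) ≡ χ a) → ∀ {i f} →
    MonoAt (K (suc k)) G (extend s) i f → ∀ a₀ → f a₀ ≡ v → StronglyMonoK k colourPattern χ
  mono-through-v {k} s χ s≗χ {i} {f} (f-inj , f-mono) a₀ fa₀≡v =
    i , g , g-inj , g-colour , g-edge
    where
    other : Fin k → Fin (suc k)
    other = punchIn a₀

    edge : ∀ {a b} → a ≢ b → E G (f a) (f b) × extend s (f a) (f b) ≡ i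
    edge a≢b = f-mono _ _ (K-edge a≢b)

    a₀≢other : ∀ j → a₀ ≢ other j
    a₀≢other j = punchInᵢ≢i a₀ j ∘ sym

    adjacent : ∀ j → E G v (f (other j))
    adjacent j = subst (λ x → E G x (f (other j))) fa₀≡v (proj₁ (edge (a₀≢other j)))

    g : Fin k → Fin d
    g j = proj₁ (enumerate-surjective (adj G v) (adjacent j))

    neighbour-g : ∀ j → neighbour (g j) ≡ f (other j)
    neighbour-g j = proj₂ (enumerate-surjective (adj G v) (adjacent j))

    g-inj : Injective _≡_ _≡_ g
    g-inj {j} {j'} gj≡gj' = punchIn-injective a₀ j j'
      (f-inj (trans (sym (neighbour-g j)) (trans (cong neighbour gj≡gj') (neighbour-g j'))))

    g-colour : ∀ j → χ (g j) ≡ i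
    g-colour j = begin
      χ (g j)                       ≡⟨ sym (s≗χ (g j)) ⟩
      s (neighbour (g j))           ≡⟨ cong s (neighbour-g j) ⟩
      s (f (other j))               ≡⟨ sym (extend-at-v s _) ⟩
      extend s v (f (other j))      ≡⟨ cong (λ x → extend s x (f (other j))) (sym fa₀≡v) ⟩
      extend s (f a₀) (f (other j)) ≡⟨ proj₂ (edge (a₀≢other j)) ⟩
      i                             ∎
      where open ≡-Reasoning

    g-edge : ∀ j j' → j ≢ j' → E (colourPattern i) (g j) (g j')
    g-edge j j' j≢j' =
      let (e , col) = edge (j≢j' ∘ punchIn-injective a₀ j j') in
      ∧-true (subst₂ (E G) (sym (neighbour-g j)) (sym (neighbour-g j')) e)
             (dec-true (_ ≟ i) (trans (sym (extend-off-v s _ _))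
                                 (trans (cong₂ (extend s) (neighbour-g j) (neighbour-g j')) col)))

  -- the colour of the edges at v to non-neighbours is irrelevant
  starColouring : (Fin d → Fin (suc r)) → Fin (suc n) → Fin (suc r)
  starColouring χ y with any? (λ a → neighbour a ≟ y)
  ... | yes (a , _) = χ a
  ... | no _        = zero

  starColouring-neighbour : ∀ χ a → starColouring χ (neighbour a) ≡ χ a
  starColouring-neighbour χ a with any? (λ b → neighbour b ≟ neighbour a)
  ... | yes (b , e) = cong χ (enumerate-injective (adj G v) e)
  ... | no ∄        = contradiction (a , refl) ∄

  colourPattern-strong : ∀ {k} → Ramsey (suc r) (K (suc k)) G →
    ¬ MonoCopy (K (suc k)) (deleteVertex G v) c →
    (χ : Fin d → Fin (suc r)) → StronglyMonoK k colourPattern χ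
  colourPattern-strong {k} R ¬mono χ with R (extend (starColouring χ) , extend-sym (starColouring χ))
  ... | i , f , mono with any? (λ a → f a ≟ v)
  ... | yes (a₀ , fa₀≡v) = mono-through-v _ χ (starColouring-neighbour χ) mono a₀ fa₀≡v
  ... | no v∉f = contradiction
    (mono-avoiding-v (K (suc k)) (starColouring χ) mono λ a v≡fa → v∉f (a , sym v≡fa)) ¬mono

  witness : ∀ {k} → Ramsey (suc r) (K (suc k)) G →
    ¬ MonoCopy (K (suc k)) (deleteVertex G v) c →
    PrWitness (suc r) k d
  witness R ¬mono =
    colourPattern , colourPattern-disjoint , colourPattern-K-free ¬mono , colourPattern-strong R ¬mono

lemma2p1 : (r k : ℕ) → 1 ≤ r → 1 ≤ k →
    ∀ {n} (G : Graph n) → RamseyMinimal r (K (suc k)) G →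
      Σ ℕ (λ m → m ≤ minDegree G × PrWitness r k m)
lemma2p1 zero    k () _ G _
lemma2p1 (suc r) k _ _ {zero} G (R , _) = contradiction R (Ramsey-empty G)
lemma2p1 (suc r) k _ _ {suc n} G (R , minimal) =
  let (v , deg-v≡δ) = minOver-attained (degree G)
      G-v = deleteVertex G v
      ((c , c-sym) , ¬mono) =
        ¬Ramsey⇒badColouring (K (suc k)) G-v (minimal G-v (deleteVertex-proper G v))
  in degree G v , ≤-reflexive deg-v≡δ , NeighbourhoodPattern.witness G v c c-sym R ¬mono
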